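{- Let $C$ be a non-degenerate $\mathbb{F}_{q^m}$-$[n,k]$ rank-metric code and let $\mathcal{M}=\mathcal{M}[C]$ be the $q$-matroid induced by $C$. Then $\operatorname{crit}(\mathcal{M})=\left\lceil\frac{n}{m}\right\rceil$.
   Context: $q$ is a prime power, $n,m\ge2$. An $\mathbb{F}_{q^m}$-$[n,k]$ rank-metric (vector) code is a $k$-dimensional $\mathbb{F}_{q^m}$-subspace $C\le\mathbb{F}_{q^m}^n$. Fix an $\mathbb{F}_q$-basis $\Gamma$ of $\mathbb{F}_{q^m}$; for $x\in\mathbb{F}_{q^m}^n$, $\Gamma(x)\in\mathbb{F}_q^{n\times m}$ has $i$-th row the coordinates of $x_i$, and $\operatorname{supp}(x)$ is the column space of $\Gamma(x)$. $C$ is non-degenerate if $\sum_{x\in C}\operatorname{supp}(x)=\mathbb{F}_q^n$. $\mathcal{M}[C]$ is the $q$-matroid on the subspace lattice of $\mathbb{F}_q^n$ with rank $\rho(W)=k-\dim_{\mathbb{F}_{q^m}}\{x\in C:\operatorname{supp}(x)\le W^\perp\}$. Its critical exponent $\operatorname{crit}(\mathcal{M})$ is the least positive integer $t$ such that there exist $x_1,\ldots,x_t\in C$ with $\sum_{i=1}^t\operatorname{supp}(x_i)=\mathbb{F}_q^n$. -}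

module Defs where

open import Level using (0ℓ)
open import Data.Nat using (ℕ; zero; suc; _^_; _≤_)
import Data.Nat as ℕ
open import Data.Nat.DivMod using (_/_)
open import Data.Nat.Primality using (Prime)
open import Data.Fin using (Fin)
import Data.Fin as Fin
open import Data.Vec using (Vec)
open import Data.Vec.Membership.Propositional using (_∈_)
open import Data.Vec.Relation.Unary.Unique.Propositional using (Unique)
open import Data.Product using (Σ; ∃; _×_)
open import Relation.Binary.PropositionalEquality using (_≡_; _≢_)
open import Algebra.Structures using (IsCommutativeRing)

IsPrimePower : ℕ → Set
IsPrimePower q = Σ ℕ λ p → Σ ℕ λ e → Prime p × q ≡ p ^ suc e

record Field : Set₁ where
  infixl 6 _+_
  infixl 7 _*_
  field
    Carrier : Set
    _+_ _*_ : Carrier → Carrier → Carrier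
    -_      : Carrier → Carrier
    0# 1#   : Carrier
    isCommutativeRing : IsCommutativeRing _≡_ _+_ _*_ -_ 0# 1#
    0≢1     : 0# ≢ 1#
    inverse : ∀ x → x ≢ 0# → ∃ λ y → x * y ≡ 1#

  Σ[_] : {t : ℕ} → (Fin t → Carrier) → Carrier
  Σ[_] {zero}  f = 0#
  Σ[_] {suc t} f = f Fin.zero + Σ[_] (λ i → f (Fin.suc i))

record FiniteField (q : ℕ) : Set₁ where
  field
    field'   : Field
  open Field field' public
  field
    elems    : Vec Carrier q
    complete : ∀ x → x ∈ elems
    distinct : Unique elems

-- An extension L of F of degree m together with a fixed F-basis Γ of L
-- (so if |F| = q then L is F_{q^m}).  `coord x` are the coordinates of x in Γ.
record Extension (F : Field) (m : ℕ) : Set₁ where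
  module F = Field F
  field
    L : Field
  module L = Field L
  field
    ι      : F.Carrier → L.Carrier
    ι-+    : ∀ a b → ι (a F.+ b) ≡ ι a L.+ ι b
    ι-*    : ∀ a b → ι (a F.* b) ≡ ι a L.* ι b
    ι-1    : ι F.1# ≡ L.1#
    Γ      : Fin m → L.Carrier
    coord  : L.Carrier → Fin m → F.Carrier
    expand : ∀ x → x ≡ L.Σ[ (λ j → ι (coord x j) L.* Γ j) ]
    unique : ∀ x (c : Fin m → F.Carrier) →
             x ≡ L.Σ[ (λ j → ι (c j) L.* Γ j) ] → ∀ j → c j ≡ coord x j

module _ {F : Field} {m : ℕ} (E : Extension F m) where
  open Extension E

  Vecₗ : ℕ → Set
  Vecₗ n = Fin n → L.Carrier

  record Code (n k : ℕ) : Set₁ where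
    field
      inC    : Vecₗ n → Set
      zero∈  : inC (λ _ → L.0#)
      +∈     : ∀ x y → inC x → inC y → inC (λ i → x i L.+ y i)
      scale∈ : ∀ (a : L.Carrier) x → inC x → inC (λ i → a L.* x i)
      basis      : Fin k → Vecₗ n
      basis∈     : ∀ r → inC (basis r)
      spans      : ∀ x → inC x → ∃ λ (a : Fin k → L.Carrier) →
                     ∀ i → x i ≡ L.Σ[ (λ r → a r L.* basis r i) ]
      independent : ∀ (a : Fin k → L.Carrier) →
                     (∀ i → L.Σ[ (λ r → a r L.* basis r i) ] ≡ L.0#) →
                     ∀ r → a r ≡ L.0#

  -- supp(x_1) + ... + supp(x_t) = F_q^n, where supp(x) is the column space of
  -- the n×m matrix Γ(x) whose (i,j) entry is coord (x i) j.
  SupportsSumFull : {n t : ℕ} → (Fin t → Vecₗ n) → Set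
  SupportsSumFull {n} {t} xs =
    ∀ (v : Fin n → F.Carrier) → ∃ λ (c : Fin t → Fin m → F.Carrier) →
      ∀ i → v i ≡ F.Σ[ (λ s → F.Σ[ (λ j → c s j F.* coord (xs s i) j) ]) ]

  module _ {n k : ℕ} (C : Code n k) where
    open Code C

    -- the sum of supp(x) over all x ∈ C is F_q^n (the span of all columns)
    NonDegenerate : Set
    NonDegenerate =
      ∀ (v : Fin n → F.Carrier) → Σ ℕ λ t → Σ (Fin t → Vecₗ n) λ xs →
        (∀ s → inC (xs s)) × ∃ λ (c : Fin t → Fin m → F.Carrier) →
          ∀ i → v i ≡ F.Σ[ (λ s → F.Σ[ (λ j → c s j F.* coord (xs s i) j) ]) ]

    HasFullSupportFamily : ℕ → Set
    HasFullSupportFamily t = Σ (Fin t → Vecₗ n) λ xs →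
      (∀ s → inC (xs s)) × SupportsSumFull xs

    -- crit(M[C]) = t : t is the least positive integer with such a family
    CriticalExponentIs : ℕ → Set
    CriticalExponentIs t = 1 ≤ t × HasFullSupportFamily t ×
      (∀ t' → 1 ≤ t' → HasFullSupportFamily t' → t ≤ t')

⌈_/_⌉ : ℕ → ℕ → ℕ
⌈ n / zero ⌉  = 0
⌈ n / suc k ⌉ = (n ℕ.+ k) / suc k

{-# OPTIONS --safe #-}
module Submission where

-- If the supports of t codewords span F_q^n, then the F_q-linear map (F_q^m)^t → F_q^n taking
-- coefficients to the corresponding combination of support columns is onto, so q^n ≤ q^(mt) and
-- t ≥ ⌈n/m⌉.  Conversely, let T = ⌈n/m⌉ and count T-tuples of codewords.  By Gaussian elimination
-- the supports of a tuple fail to span exactly when some nonzero u ∈ F_q^n annihilates all of them.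
-- For fixed u ≠ 0 nondegeneracy makes the syndrome of u (its pairing with the generator rows)
-- nonzero, so annihilation is a nontrivial linear condition on the coefficient vector of each
-- codeword and holds for at most a fraction q^(-m) of them.  A union bound over the fewer than
-- q^n ≤ q^(mT) nonzero u leaves a tuple whose supports span.

open import Defs
open import Level using (0ℓ)
open import Algebra.Bundles using (CommutativeRing)
import Algebra.Properties.Ring as RingProperties
import Algebra.Properties.Semiring.Sum as SemiringSum
open import Data.Nat using (ℕ; zero; suc; _≤_; _<_; z≤n; s≤s; NonZero; >-nonZero)
import Data.Nat as ℕ
open import Data.Nat.Properties
  using (≤-trans; ≤-reflexive; ≤-pred; <-≤-trans; m≤n⇒m≤1+n; n≤1+n; m<m+n; +-mono-≤; +-monoˡ-≤; +-monoʳ-≤;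
         *-monoˡ-≤; ^-monoˡ-≤; ^-monoʳ-≤; m^n>0; ^-*-assoc; ^-distribˡ-+-*; module ≤-Reasoning)
import Data.Nat.Properties as ℕₚ
open import Data.Nat.DivMod using (_/_; _%_; m≡m%n+[m/n]*n; m%n<n; /-monoˡ-≤; n/n≡1; m<n*o⇒m/o<n)
open import Data.Nat.Primality using (prime⇒nonZero; prime⇒nonTrivial)
open import Data.Nat.Base using (nonTrivial⇒n>1)
open import Data.Nat.ListAction using (sum)
open import Data.List as List using (List; []; _∷_; _++_; map; length; cartesianProductWith)
open import Data.List.Properties using (length-++; length-map)
open import Data.List.Membership.Propositional using (_∈_; lose)
open import Data.List.Membership.Propositional.Properties
  using (∈-cartesianProductWith⁺; ∈-map⁺; ∈-∃++; ∈-++⁻; ∈-++⁺ˡ; ∈-++⁺ʳ)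
open import Data.List.Relation.Unary.Any as Any using (Any; here; there; any?)
import Data.List.Relation.Unary.Any.Properties as Any
open import Data.List.Relation.Unary.All using (All; []; _∷_)
open import Data.List.Relation.Unary.AllPairs using ([]; _∷_)
open import Data.List.Relation.Unary.Unique.Propositional using (Unique)
import Data.List.Relation.Unary.Unique.Propositional.Properties as Unique
open import Data.Vec using (Vec; []; _∷_; lookup; tabulate; replicate; toList)
import Data.Vec.Properties as Vec
open import Data.Vec.Relation.Unary.AllPairs using ([]; _∷_)
import Data.Vec.Relation.Unary.Unique.Propositional as VecUnique
import Data.Vec.Relation.Unary.All.Properties as VecAll
open import Data.Vec.Membership.Propositional.Properties using (∈-toList⁺)
open import Data.Fin using (Fin)
import Data.Fin as Fin
import Data.Fin.Properties as Fin
open import Data.Empty using (⊥-elim)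
open import Data.Sum as Sum using (_⊎_; inj₁; inj₂; [_,_]′)
open import Data.Product using (_,_; proj₁; proj₂; ∃; _×_)
open import Function using (id; _∘_)
open import Relation.Nullary using (¬_; Dec; yes; no; ¬?)
open import Relation.Nullary.Decidable using (decidable-stable; _×-dec_)
open import Relation.Binary.Definitions using (DecidableEquality)
open import Relation.Binary.PropositionalEquality

module FieldProperties (K : Field) where
  open Field K public

  commutativeRing : CommutativeRing 0ℓ 0ℓ
  commutativeRing = record { isCommutativeRing = isCommutativeRing }

  open CommutativeRing commutativeRing public
    using (+-assoc; +-comm; +-identityˡ; +-identityʳ; -‿inverseˡ;
           *-assoc; *-comm; *-identityˡ; *-identityʳ; distribˡ; distribʳ; zeroˡ; zeroʳ; semiring; ring; _-_)
  open RingProperties ring public using (+-identityʳ-unique; x≈z//y)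
  open SemiringSum semiring using (sum-cong-≗; ∑-distrib-+; ∑-comm; *-distribˡ-sum; sum-replicate-zero)
    renaming (sum to ∑)
  open ≡-Reasoning

  x≡y-z⇒x+z≡y : ∀ {x y z} → x ≡ y - z → x + z ≡ y
  x≡y-z⇒x+z≡y {x} {y} {z} refl = begin
    (y + - z) + z ≡⟨ +-assoc y (- z) z ⟩
    y + (- z + z) ≡⟨ cong (y +_) (-‿inverseˡ z) ⟩
    y + 0#        ≡⟨ +-identityʳ y ⟩
    y             ∎

  *-cancelʳ : ∀ {x y z} → z ≢ 0# → x * z ≡ y * z → x ≡ y
  *-cancelʳ {x} {y} {z} z≢0 xz≡yz with inverse z z≢0
  ... | z⁻¹ , zz⁻¹≡1 = begin
    x                ≡⟨ sym (*-identityʳ x) ⟩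
    x * 1#           ≡⟨ cong (x *_) (sym zz⁻¹≡1) ⟩
    x * (z * z⁻¹)    ≡⟨ sym (*-assoc x z z⁻¹) ⟩
    (x * z) * z⁻¹    ≡⟨ cong (_* z⁻¹) xz≡yz ⟩
    (y * z) * z⁻¹    ≡⟨ *-assoc y z z⁻¹ ⟩
    y * (z * z⁻¹)    ≡⟨ cong (y *_) zz⁻¹≡1 ⟩
    y * 1#           ≡⟨ *-identityʳ y ⟩
    y                ∎

  x*[y*z]≡y*[x*z] : ∀ x y z → x * (y * z) ≡ y * (x * z)
  x*[y*z]≡y*[x*z] x y z = trans (sym (*-assoc x y z)) (trans (cong (_* z) (*-comm x y)) (*-assoc y x z))

  x+[y-x]≡y : ∀ x y → x + (y - x) ≡ y
  x+[y-x]≡y x y = trans (+-comm x (y - x)) (x≡y-z⇒x+z≡y refl)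

  x+y≡z⇒y≡z-x : ∀ {x y z} → x + y ≡ z → y ≡ z - x
  x+y≡z⇒y≡z-x {x} {y} {z} x+y≡z = x≈z//y y x z (trans (+-comm y x) x+y≡z)

  Σ≡∑ : ∀ {t} (f : Fin t → Carrier) → Σ[ f ] ≡ ∑ f
  Σ≡∑ {zero}  f = refl
  Σ≡∑ {suc t} f = cong (f Fin.zero +_) (Σ≡∑ (λ i → f (Fin.suc i)))

  Σ-cong : ∀ {t} {f g : Fin t → Carrier} → (∀ i → f i ≡ g i) → Σ[ f ] ≡ Σ[ g ]
  Σ-cong {zero}  f≗g = refl
  Σ-cong {suc t} f≗g = cong₂ _+_ (f≗g Fin.zero) (Σ-cong (λ i → f≗g (Fin.suc i)))

  Σ-zero : ∀ {t} {f : Fin t → Carrier} → (∀ i → f i ≡ 0#) → Σ[ f ] ≡ 0#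
  Σ-zero {t} f≗0 = trans (Σ-cong f≗0) (trans (Σ≡∑ {t} (λ _ → 0#)) (sum-replicate-zero t))

  Σ-distrib-+ : ∀ {t} (f g : Fin t → Carrier) → Σ[ (λ i → f i + g i) ] ≡ Σ[ f ] + Σ[ g ]
  Σ-distrib-+ f g = begin
    Σ[ (λ i → f i + g i) ] ≡⟨ Σ≡∑ (λ i → f i + g i) ⟩
    ∑ (λ i → f i + g i)    ≡⟨ ∑-distrib-+ f g ⟩
    ∑ f + ∑ g              ≡⟨ sym (cong₂ _+_ (Σ≡∑ f) (Σ≡∑ g)) ⟩
    Σ[ f ] + Σ[ g ]        ∎

  *-distribˡ-Σ : ∀ {t} x (f : Fin t → Carrier) → x * Σ[ f ] ≡ Σ[ (λ i → x * f i) ]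
  *-distribˡ-Σ x f = begin
    x * Σ[ f ]             ≡⟨ cong (x *_) (Σ≡∑ f) ⟩
    x * ∑ f                ≡⟨ *-distribˡ-sum x f ⟩
    ∑ (λ i → x * f i)      ≡⟨ sym (Σ≡∑ (λ i → x * f i)) ⟩
    Σ[ (λ i → x * f i) ]   ∎

  *-distribʳ-Σ : ∀ {t} x (f : Fin t → Carrier) → Σ[ f ] * x ≡ Σ[ (λ i → f i * x) ]
  *-distribʳ-Σ x f = begin
    Σ[ f ] * x             ≡⟨ *-comm _ x ⟩
    x * Σ[ f ]             ≡⟨ *-distribˡ-Σ x f ⟩
    Σ[ (λ i → x * f i) ]   ≡⟨ Σ-cong (λ i → *-comm x (f i)) ⟩
    Σ[ (λ i → f i * x) ]   ∎

  Σ-comm : ∀ {s t} (f : Fin s → Fin t → Carrier) →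
           Σ[ (λ i → Σ[ (λ j → f i j) ]) ] ≡ Σ[ (λ j → Σ[ (λ i → f i j) ]) ]
  Σ-comm f = begin
    Σ[ (λ i → Σ[ (λ j → f i j) ]) ] ≡⟨ Σ≡∑ (λ i → Σ[ f i ]) ⟩
    ∑ (λ i → Σ[ (λ j → f i j) ])    ≡⟨ sum-cong-≗ (λ i → Σ≡∑ (f i)) ⟩
    ∑ (λ i → ∑ (λ j → f i j))       ≡⟨ ∑-comm f ⟩
    ∑ (λ j → ∑ (λ i → f i j))       ≡⟨ sum-cong-≗ (λ j → sym (Σ≡∑ (λ i → f i j))) ⟩
    ∑ (λ j → Σ[ (λ i → f i j) ])    ≡⟨ sym (Σ≡∑ (λ j → Σ[ (λ i → f i j) ])) ⟩
    Σ[ (λ j → Σ[ (λ i → f i j) ]) ] ∎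

  Σ-select : ∀ {t} (i₀ : Fin t) (f : Fin t → Carrier) → (∀ i → i ≢ i₀ → f i ≡ 0#) → Σ[ f ] ≡ f i₀
  Σ-select Fin.zero f f≡0 = begin
    f Fin.zero + Σ[ (λ i → f (Fin.suc i)) ] ≡⟨ cong (f Fin.zero +_) (Σ-zero (λ i → f≡0 (Fin.suc i) (λ ()))) ⟩
    f Fin.zero + 0#                        ≡⟨ +-identityʳ _ ⟩
    f Fin.zero                             ∎
  Σ-select (Fin.suc i₀) f f≡0 = begin
    f Fin.zero + Σ[ (λ i → f (Fin.suc i)) ] ≡⟨ cong (_+ Σ[ (λ i → f (Fin.suc i)) ]) (f≡0 Fin.zero (λ ())) ⟩
    0# + Σ[ (λ i → f (Fin.suc i)) ]        ≡⟨ +-identityˡ _ ⟩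
    Σ[ (λ i → f (Fin.suc i)) ]             ≡⟨ Σ-select i₀ _ (λ i i≢i₀ → f≡0 (Fin.suc i) (i≢i₀ ∘ Fin.suc-injective)) ⟩
    f (Fin.suc i₀)                         ∎

  Σ-*-Σ-comm : ∀ {s t} (x : Fin s → Carrier) (y : Fin t → Carrier) (M : Fin s → Fin t → Carrier) →
    Σ[ (λ i → x i * Σ[ (λ j → y j * M i j) ]) ] ≡ Σ[ (λ j → y j * Σ[ (λ i → x i * M i j) ]) ]
  Σ-*-Σ-comm x y M = begin
    Σ[ (λ i → x i * Σ[ (λ j → y j * M i j) ]) ]   ≡⟨ Σ-cong (λ i → *-distribˡ-Σ (x i) (λ j → y j * M i j)) ⟩
    Σ[ (λ i → Σ[ (λ j → x i * (y j * M i j)) ]) ] ≡⟨ Σ-comm (λ i j → x i * (y j * M i j)) ⟩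
    Σ[ (λ j → Σ[ (λ i → x i * (y j * M i j)) ]) ] ≡⟨ Σ-cong (λ j → Σ-cong (λ i → x*[y*z]≡y*[x*z] (x i) (y j) (M i j))) ⟩
    Σ[ (λ j → Σ[ (λ i → y j * (x i * M i j)) ]) ] ≡⟨ Σ-cong (λ j → sym (*-distribˡ-Σ (y j) (λ i → x i * M i j))) ⟩
    Σ[ (λ j → y j * Σ[ (λ i → x i * M i j) ]) ]   ∎

  δ : ∀ {t} → Fin t → Fin t → Carrier
  δ i₀ i with i Fin.≟ i₀
  ... | yes _ = 1#
  ... | no  _ = 0#

  Σ-*-δ : ∀ {t} (u : Fin t → Carrier) (i₀ : Fin t) → Σ[ (λ i → u i * δ i₀ i) ] ≡ u i₀
  Σ-*-δ u i₀ = trans (Σ-select i₀ (λ i → u i * δ i₀ i) off-diagonal) on-diagonal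
    where
    off-diagonal : ∀ i → i ≢ i₀ → u i * δ i₀ i ≡ 0#
    off-diagonal i i≢i₀ with i Fin.≟ i₀
    ... | yes i≡i₀ = ⊥-elim (i≢i₀ i≡i₀)
    ... | no  _    = zeroʳ (u i)
    on-diagonal : u i₀ * δ i₀ i₀ ≡ u i₀
    on-diagonal with i₀ Fin.≟ i₀
    ... | yes _    = *-identityʳ (u i₀)
    ... | no i₀≢i₀ = ⊥-elim (i₀≢i₀ refl)

module Matrices (K : Field) where
  open FieldProperties K
  open ≡-Reasoning

  -- Columns are indexed by pairs (s , j), so that ColumnsSpan below unfolds to SupportsSumFull
  -- for the matrix with entries coord (x s i) j.
  Matrix : ℕ → ℕ → ℕ → Set
  Matrix n t m = Fin n → Fin t → Fin m → Carrier

  infix 7 _·_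
  _·_ : ∀ {t m} → (Fin t → Fin m → Carrier) → (Fin t → Fin m → Carrier) → Carrier
  c · r = Σ[ (λ s → Σ[ (λ j → c s j * r s j) ]) ]

  ColumnsSpan : ∀ {n t m} → Matrix n t m → Set
  ColumnsSpan {n} {t} {m} M =
    ∀ (v : Fin n → Carrier) → ∃ λ (c : Fin t → Fin m → Carrier) → ∀ i → v i ≡ c · M i

  RowsDependent : ∀ {n t m} → Matrix n t m → Set
  RowsDependent {n} M = ∃ λ (u : Fin n → Carrier) → (∃ λ i → u i ≢ 0#) × (∀ s j → Σ[ (λ i → u i * M i s j) ] ≡ 0#)

  ·-congˡ : ∀ {t m} (r : Fin t → Fin m → Carrier) {c c′ : Fin t → Fin m → Carrier} →
            (∀ s j → c s j ≡ c′ s j) → c · r ≡ c′ · r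
  ·-congˡ r c≗c′ = Σ-cong (λ s → Σ-cong (λ j → cong (_* r s j) (c≗c′ s j)))

  ·-congʳ : ∀ {t m} (c : Fin t → Fin m → Carrier) {r r′ : Fin t → Fin m → Carrier} →
            (∀ s j → r s j ≡ r′ s j) → c · r ≡ c · r′
  ·-congʳ c r≗r′ = Σ-cong (λ s → Σ-cong (λ j → cong (c s j *_) (r≗r′ s j)))

  ·-distribʳ-+ : ∀ {t m} (c d r : Fin t → Fin m → Carrier) →
                 (λ s j → c s j + d s j) · r ≡ c · r + d · r
  ·-distribʳ-+ c d r = begin
    (λ s j → c s j + d s j) · r
      ≡⟨ Σ-cong (λ s → Σ-cong (λ j → distribʳ (r s j) (c s j) (d s j))) ⟩
    Σ[ (λ s → Σ[ (λ j → c s j * r s j + d s j * r s j) ]) ]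
      ≡⟨ Σ-cong (λ s → Σ-distrib-+ (λ j → c s j * r s j) (λ j → d s j * r s j)) ⟩
    Σ[ (λ s → Σ[ (λ j → c s j * r s j) ] + Σ[ (λ j → d s j * r s j) ]) ]
      ≡⟨ Σ-distrib-+ (λ s → Σ[ (λ j → c s j * r s j) ]) (λ s → Σ[ (λ j → d s j * r s j) ]) ⟩
    c · r + d · r ∎

  ·-linearˡ : ∀ {t m} (c r r′ : Fin t → Fin m → Carrier) a →
              c · (λ s j → r s j + a * r′ s j) ≡ c · r + a * (c · r′)
  ·-linearˡ c r r′ a = begin
    c · (λ s j → r s j + a * r′ s j)
      ≡⟨ Σ-cong (λ s → Σ-cong (λ j → distribˡ (c s j) (r s j) (a * r′ s j))) ⟩
    Σ[ (λ s → Σ[ (λ j → c s j * r s j + c s j * (a * r′ s j)) ]) ]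
      ≡⟨ Σ-cong (λ s → Σ-distrib-+ (λ j → c s j * r s j) (λ j → c s j * (a * r′ s j))) ⟩
    Σ[ (λ s → Σ[ (λ j → c s j * r s j) ] + Σ[ (λ j → c s j * (a * r′ s j)) ]) ]
      ≡⟨ Σ-distrib-+ (λ s → Σ[ (λ j → c s j * r s j) ]) (λ s → Σ[ (λ j → c s j * (a * r′ s j)) ]) ⟩
    c · r + Σ[ (λ s → Σ[ (λ j → c s j * (a * r′ s j)) ]) ]
      ≡⟨ cong (c · r +_) (Σ-cong (λ s → Σ-cong (λ j → x*[y*z]≡y*[x*z] (c s j) a (r′ s j)))) ⟩
    c · r + Σ[ (λ s → Σ[ (λ j → a * (c s j * r′ s j)) ]) ]
      ≡⟨ cong (c · r +_) (Σ-cong (λ s → sym (*-distribˡ-Σ a (λ j → c s j * r′ s j)))) ⟩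
    c · r + Σ[ (λ s → a * Σ[ (λ j → c s j * r′ s j) ]) ]
      ≡⟨ cong (c · r +_) (sym (*-distribˡ-Σ a (λ s → Σ[ (λ j → c s j * r′ s j) ]))) ⟩
    c · r + a * (c · r′) ∎

  Σ-*-· : ∀ {n t m} (u : Fin n → Carrier) (c : Fin t → Fin m → Carrier) (M : Matrix n t m) →
          Σ[ (λ i → u i * (c · M i)) ] ≡ c · (λ s j → Σ[ (λ i → u i * M i s j) ])
  Σ-*-· u c M = begin
    Σ[ (λ i → u i * (c · M i)) ]
      ≡⟨ Σ-cong (λ i → *-distribˡ-Σ (u i) (λ s → Σ[ (λ j → c s j * M i s j) ])) ⟩
    Σ[ (λ i → Σ[ (λ s → u i * Σ[ (λ j → c s j * M i s j) ]) ]) ]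
      ≡⟨ Σ-comm (λ i s → u i * Σ[ (λ j → c s j * M i s j) ]) ⟩
    Σ[ (λ s → Σ[ (λ i → u i * Σ[ (λ j → c s j * M i s j) ]) ]) ]
      ≡⟨ Σ-cong (λ s → Σ-*-Σ-comm u (c s) (λ i j → M i s j)) ⟩
    c · (λ s j → Σ[ (λ i → u i * M i s j) ]) ∎

  single : ∀ {t m} → Fin t → Fin m → Carrier → Fin t → Fin m → Carrier
  single s₀ j₀ l s j with s Fin.≟ s₀ | j Fin.≟ j₀
  ... | yes _ | yes _ = l
  ... | _     | _     = 0#

  ·-single : ∀ {t m} (s₀ : Fin t) (j₀ : Fin m) l r → single s₀ j₀ l · r ≡ l * r s₀ j₀
  ·-single s₀ j₀ l r = begin
    single s₀ j₀ l · r                          ≡⟨ Σ-select s₀ _ (λ s s≢s₀ → Σ-zero (λ j → off-row s j s≢s₀)) ⟩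
    Σ[ (λ j → single s₀ j₀ l s₀ j * r s₀ j) ]   ≡⟨ Σ-select j₀ _ off-column ⟩
    single s₀ j₀ l s₀ j₀ * r s₀ j₀              ≡⟨ cong (_* r s₀ j₀) at-pivot ⟩
    l * r s₀ j₀                                 ∎
    where
    off-row : ∀ s j → s ≢ s₀ → single s₀ j₀ l s j * r s j ≡ 0#
    off-row s j s≢s₀ with s Fin.≟ s₀ | j Fin.≟ j₀
    ... | yes s≡s₀ | _     = ⊥-elim (s≢s₀ s≡s₀)
    ... | no _     | _     = zeroˡ _
    off-column : ∀ j → j ≢ j₀ → single s₀ j₀ l s₀ j * r s₀ j ≡ 0#
    off-column j j≢j₀ with s₀ Fin.≟ s₀ | j Fin.≟ j₀
    ... | _     | yes j≡j₀ = ⊥-elim (j≢j₀ j≡j₀)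
    ... | yes _ | no _     = zeroˡ _
    ... | no _  | no _     = zeroˡ _
    at-pivot : single s₀ j₀ l s₀ j₀ ≡ l
    at-pivot with s₀ Fin.≟ s₀ | j₀ Fin.≟ j₀
    ... | yes _    | yes _    = refl
    ... | no s₀≢s₀ | _        = ⊥-elim (s₀≢s₀ refl)
    ... | yes _    | no j₀≢j₀ = ⊥-elim (j₀≢j₀ refl)

  module PivotStep {n t m} (M : Matrix (suc n) t m) (s₀ : Fin t) (j₀ : Fin m)
                   (p⁻¹ : Carrier) (pp⁻¹≡1 : M Fin.zero s₀ j₀ * p⁻¹ ≡ 1#) where
    p : Carrier
    p = M Fin.zero s₀ j₀

    [x*p⁻¹]*p≡x : ∀ x → (x * p⁻¹) * p ≡ x
    [x*p⁻¹]*p≡x x = begin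
      (x * p⁻¹) * p ≡⟨ *-assoc x p⁻¹ p ⟩
      x * (p⁻¹ * p) ≡⟨ cong (x *_) (trans (*-comm p⁻¹ p) pp⁻¹≡1) ⟩
      x * 1#        ≡⟨ *-identityʳ x ⟩
      x             ∎

    μ : Fin n → Carrier
    μ i = M (Fin.suc i) s₀ j₀ * p⁻¹

    reduced : Matrix n t m
    reduced i s j = M (Fin.suc i) s j - μ i * M Fin.zero s j

    M-suc≡reduced+μM₀ : ∀ i s j → M (Fin.suc i) s j ≡ reduced i s j + μ i * M Fin.zero s j
    M-suc≡reduced+μM₀ i s j = sym (x≡y-z⇒x+z≡y refl)

    module ExtendSolution (v : Fin (suc n) → Carrier) (c′ : Fin t → Fin m → Carrier)
                          (solves′ : ∀ i → v (Fin.suc i) - μ i * v Fin.zero ≡ c′ · reduced i) where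
      r₀ l : Carrier
      r₀ = c′ · M Fin.zero
      l  = (v Fin.zero - r₀) * p⁻¹

      c : Fin t → Fin m → Carrier
      c s j = c′ s j + single s₀ j₀ l s j

      c·M : ∀ i → c · M i ≡ c′ · M i + l * M i s₀ j₀
      c·M i = trans (·-distribʳ-+ c′ (single s₀ j₀ l) (M i)) (cong (c′ · M i +_) (·-single s₀ j₀ l (M i)))

      l*M-suc : ∀ i → l * M (Fin.suc i) s₀ j₀ ≡ μ i * (v Fin.zero - r₀)
      l*M-suc i = begin
        l * M (Fin.suc i) s₀ j₀ ≡⟨ cong (l *_) (sym ([x*p⁻¹]*p≡x _)) ⟩
        l * (μ i * p)           ≡⟨ x*[y*z]≡y*[x*z] l (μ i) p ⟩
        μ i * (l * p)           ≡⟨ cong (μ i *_) ([x*p⁻¹]*p≡x _) ⟩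
        μ i * (v Fin.zero - r₀) ∎

      solves : ∀ i → v i ≡ c · M i
      solves Fin.zero = sym (begin
        c · M Fin.zero          ≡⟨ c·M Fin.zero ⟩
        r₀ + l * p              ≡⟨ cong (r₀ +_) ([x*p⁻¹]*p≡x _) ⟩
        r₀ + (v Fin.zero - r₀)  ≡⟨ x+[y-x]≡y r₀ (v Fin.zero) ⟩
        v Fin.zero              ∎)
      solves (Fin.suc i) = sym (begin
        c · M (Fin.suc i)
          ≡⟨ c·M (Fin.suc i) ⟩
        c′ · M (Fin.suc i) + l * M (Fin.suc i) s₀ j₀
          ≡⟨ cong₂ _+_ (trans (·-congʳ c′ (M-suc≡reduced+μM₀ i)) (·-linearˡ c′ (reduced i) (M Fin.zero) (μ i)))
                       (l*M-suc i) ⟩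
        (c′ · reduced i + μ i * r₀) + μ i * (v Fin.zero - r₀)
          ≡⟨ +-assoc _ _ _ ⟩
        c′ · reduced i + (μ i * r₀ + μ i * (v Fin.zero - r₀))
          ≡⟨ cong₂ _+_ (sym (solves′ i))
                       (trans (sym (distribˡ (μ i) _ _)) (cong (μ i *_) (x+[y-x]≡y r₀ (v Fin.zero)))) ⟩
        (v (Fin.suc i) - μ i * v Fin.zero) + μ i * v Fin.zero
          ≡⟨ x≡y-z⇒x+z≡y refl ⟩
        v (Fin.suc i) ∎)

    reduced-span⇒span : ColumnsSpan reduced → ColumnsSpan M
    reduced-span⇒span span v = c , solves
      where open ExtendSolution v (proj₁ (span _)) (proj₂ (span _))

    reduced-dependent⇒dependent : RowsDependent reduced → RowsDependent M
    reduced-dependent⇒dependent (u′ , (i₀ , u′i₀≢0) , u′reduced≡0) = u , (Fin.suc i₀ , u′i₀≢0) , uM≡0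
      where
      S : Carrier
      S = Σ[ (λ i → u′ i * μ i) ]
      u : Fin (suc n) → Carrier
      u Fin.zero    = - S
      u (Fin.suc i) = u′ i
      uM≡0 : ∀ s j → Σ[ (λ i → u i * M i s j) ] ≡ 0#
      uM≡0 s j = begin
        - S * M₀ + Σ[ (λ i → u′ i * M (Fin.suc i) s j) ] ≡⟨ cong (- S * M₀ +_) tail≡SM₀ ⟩
        - S * M₀ + S * M₀                                ≡⟨ sym (distribʳ M₀ (- S) S) ⟩
        (- S + S) * M₀                                   ≡⟨ cong (_* M₀) (-‿inverseˡ S) ⟩
        0# * M₀                                          ≡⟨ zeroˡ M₀ ⟩
        0#                                               ∎
        where
        M₀ : Carrier
        M₀ = M Fin.zero s j
        tail≡SM₀ : Σ[ (λ i → u′ i * M (Fin.suc i) s j) ] ≡ S * M₀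
        tail≡SM₀ = begin
          Σ[ (λ i → u′ i * M (Fin.suc i) s j) ]
            ≡⟨ Σ-cong (λ i → trans (cong (u′ i *_) (M-suc≡reduced+μM₀ i s j))
                 (trans (distribˡ (u′ i) _ _) (cong (u′ i * reduced i s j +_) (sym (*-assoc (u′ i) (μ i) M₀))))) ⟩
          Σ[ (λ i → u′ i * reduced i s j + (u′ i * μ i) * M₀) ]
            ≡⟨ Σ-distrib-+ (λ i → u′ i * reduced i s j) (λ i → (u′ i * μ i) * M₀) ⟩
          Σ[ (λ i → u′ i * reduced i s j) ] + Σ[ (λ i → (u′ i * μ i) * M₀) ]
            ≡⟨ cong₂ _+_ (u′reduced≡0 s j) (sym (*-distribʳ-Σ M₀ (λ i → u′ i * μ i))) ⟩
          0# + S * M₀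
            ≡⟨ +-identityˡ _ ⟩
          S * M₀ ∎

  zero-row⇒dependent : ∀ {n t m} (M : Matrix (suc n) t m) → (∀ s j → M Fin.zero s j ≡ 0#) → RowsDependent M
  zero-row⇒dependent {n} M M₀≡0 = u , (Fin.zero , 0≢1 ∘ sym) , uM≡0
    where
    u : Fin (suc n) → Carrier
    u Fin.zero    = 1#
    u (Fin.suc i) = 0#
    uM≡0 : ∀ s j → Σ[ (λ i → u i * M i s j) ] ≡ 0#
    uM≡0 s j = begin
      1# * M Fin.zero s j + Σ[ (λ i → 0# * M (Fin.suc i) s j) ]
        ≡⟨ cong₂ _+_ (*-identityˡ _) (Σ-zero {n} (λ i → zeroˡ (M (Fin.suc i) s j))) ⟩
      M Fin.zero s j + 0#
        ≡⟨ +-identityʳ _ ⟩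
      M Fin.zero s j
        ≡⟨ M₀≡0 s j ⟩
      0# ∎

  columnsSpan⊎rowsDependent : DecidableEquality Carrier → ∀ {n t m} (M : Matrix n t m) →
                              ColumnsSpan M ⊎ RowsDependent M
  columnsSpan⊎rowsDependent _≟_ {zero}  M = inj₁ (λ v → (λ _ _ → 0#) , λ ())
  columnsSpan⊎rowsDependent _≟_ {suc n} M with Fin.any? (λ s → Fin.any? (λ j → ¬? (M Fin.zero s j ≟ 0#)))
  ... | no no-pivot =
    inj₂ (zero-row⇒dependent M (λ s j → decidable-stable (M Fin.zero s j ≟ 0#) (λ ≢0 → no-pivot (s , j , ≢0))))
  ... | yes (s₀ , j₀ , p≢0) with inverse (M Fin.zero s₀ j₀) p≢0
  ...   | p⁻¹ , pp⁻¹≡1 = Sum.map reduced-span⇒span reduced-dependent⇒dependent (columnsSpan⊎rowsDependent _≟_ reduced)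
    where open PivotStep M s₀ j₀ p⁻¹ pp⁻¹≡1


module Counting where
  open Data.Nat using (_+_; _*_; _^_)
  open ℕₚ using (+-suc; +-comm; +-assoc)

  private variable
    A B C : Set

  count : {P : A → Set} → (∀ x → Dec (P x)) → List A → ℕ
  count P? [] = 0
  count P? (x ∷ xs) with P? x
  ... | yes _ = suc (count P? xs)
  ... | no  _ = count P? xs

  module _ {P : A → Set} (P? : ∀ x → Dec (P x)) where

    count-≤-length : ∀ xs → count P? xs ≤ length xs
    count-≤-length [] = z≤n
    count-≤-length (x ∷ xs) with P? x
    ... | yes _ = s≤s (count-≤-length xs)
    ... | no  _ = m≤n⇒m≤1+n (count-≤-length xs)

    count-empty : (∀ x → ¬ P x) → ∀ xs → count P? xs ≡ 0
    count-empty ∄P [] = refl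
    count-empty ∄P (x ∷ xs) with P? x
    ... | yes Px = ⊥-elim (∄P x Px)
    ... | no  _  = count-empty ∄P xs

    count-++ : ∀ xs ys → count P? (xs ++ ys) ≡ count P? xs + count P? ys
    count-++ [] ys = refl
    count-++ (x ∷ xs) ys with P? x
    ... | yes _ = cong suc (count-++ xs ys)
    ... | no  _ = count-++ xs ys

    count-map : (f : B → A) → ∀ xs → count P? (map f xs) ≡ count (λ x → P? (f x)) xs
    count-map f [] = refl
    count-map f (x ∷ xs) with P? (f x)
    ... | yes _ = cong suc (count-map f xs)
    ... | no  _ = count-map f xs

    count-cartesianProductWith : (f : B → C → A) → ∀ xs ys →
      count P? (cartesianProductWith f xs ys) ≡ sum (map (λ x → count (λ y → P? (f x y)) ys) xs)
    count-cartesianProductWith f [] ys = refl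
    count-cartesianProductWith f (x ∷ xs) ys = trans (count-++ (map (f x) ys) _)
      (cong₂ _+_ (count-map (f x) ys) (count-cartesianProductWith f xs ys))

    count<length⇒∃¬ : ∀ xs → count P? xs < length xs → ∃ λ x → ¬ P x
    count<length⇒∃¬ (x ∷ xs) count<length with P? x
    ... | yes _  = count<length⇒∃¬ xs (≤-pred count<length)
    ... | no ¬Px = x , ¬Px

    count-≤1 : (∀ {x y} → P x → P y → x ≡ y) → ∀ {xs} → Unique xs → count P? xs ≤ 1
    count-≤1 P-unique {[]} _ = z≤n
    count-≤1 P-unique {x ∷ xs} (x∉xs ∷ unique) with P? x
    ... | yes Px = s≤s (≤-reflexive (no-other x∉xs))
      where
      no-other : ∀ {ys} → All (x ≢_) ys → count P? ys ≡ 0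
      no-other {[]} [] = refl
      no-other {y ∷ ys} (x≢y ∷ x≢ys) with P? y
      ... | yes Py = ⊥-elim (x≢y (P-unique Px Py))
      ... | no  _  = no-other x≢ys
    ... | no _ = count-≤1 P-unique unique

  module _ {P Q : A → Set} (P? : ∀ x → Dec (P x)) (Q? : ∀ x → Dec (Q x)) where

    count-mono : (∀ x → P x → Q x) → ∀ xs → count P? xs ≤ count Q? xs
    count-mono P⊆Q [] = z≤n
    count-mono P⊆Q (x ∷ xs) with P? x | Q? x
    ... | yes _  | yes _  = s≤s (count-mono P⊆Q xs)
    ... | yes Px | no ¬Qx = ⊥-elim (¬Qx (P⊆Q x Px))
    ... | no _   | yes _  = m≤n⇒m≤1+n (count-mono P⊆Q xs)
    ... | no _   | no _   = count-mono P⊆Q xs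

    count-∪ : {R : A → Set} (R? : ∀ x → Dec (R x)) → (∀ x → P x → Q x ⊎ R x) →
              ∀ xs → count P? xs ≤ count Q? xs + count R? xs
    count-∪ R? P⊆Q∪R [] = z≤n
    count-∪ R? P⊆Q∪R (x ∷ xs) with ih ← count-∪ R? P⊆Q∪R xs | P? x | Q? x | R? x
    ... | yes _  | yes _  | yes _  = s≤s (≤-trans ih (+-monoʳ-≤ (count Q? xs) (n≤1+n (count R? xs))))
    ... | yes _  | yes _  | no _   = s≤s ih
    ... | yes _  | no _   | yes _  = ≤-trans (s≤s ih) (≤-reflexive (sym (+-suc _ _)))
    ... | yes Px | no ¬Qx | no ¬Rx = ⊥-elim ([ ¬Qx , ¬Rx ]′ (P⊆Q∪R x Px))
    ... | no _   | yes _  | yes _  = ≤-trans ih (+-mono-≤ (n≤1+n (count Q? xs)) (n≤1+n (count R? xs)))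
    ... | no _   | yes _  | no _   = m≤n⇒m≤1+n ih
    ... | no _   | no _   | yes _  = ≤-trans ih (+-monoʳ-≤ (count Q? xs) (n≤1+n (count R? xs)))
    ... | no _   | no _   | no _   = ih

  count-⋃ : {P : A → Set} {Q : B → A → Set} (P? : ∀ x → Dec (P x)) (Q? : ∀ u x → Dec (Q u x)) →
    ∀ us → (∀ x → P x → Any (λ u → Q u x) us) → ∀ xs → count P? xs ≤ sum (map (λ u → count (Q? u) xs) us)
  count-⋃ {Q = Q} P? Q? [] P⊆⋃ xs = ≤-reflexive (count-empty P? (λ x Px → ∉[] (P⊆⋃ x Px)) xs)
    where
    ∉[] : ∀ {x} → ¬ Any (λ u → Q u x) []
    ∉[] ()
  count-⋃ {P = P} {Q = Q} P? Q? (u ∷ us) P⊆⋃ xs = begin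
    count P? xs                                            ≤⟨ count-∪ P? (Q? u) Rest? split xs ⟩
    count (Q? u) xs + count Rest? xs                       ≤⟨ +-monoʳ-≤ _ (count-⋃ Rest? Q? us (λ _ → id) xs) ⟩
    count (Q? u) xs + sum (map (λ u → count (Q? u) xs) us) ∎
    where
    open ≤-Reasoning
    Rest? : ∀ x → Dec (Any (λ u → Q u x) us)
    Rest? x = any? (λ u → Q? u x) us
    split : ∀ x → P x → Q u x ⊎ Any (λ u → Q u x) us
    split x Px with P⊆⋃ x Px
    ... | here  Qux     = inj₁ Qux
    ... | there in-rest = inj₂ in-rest

  sum-map-≤ : (g : A → ℕ) {b : ℕ} → (∀ x → g x ≤ b) → ∀ xs → sum (map g xs) ≤ length xs * b
  sum-map-≤ g g≤b [] = z≤n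
  sum-map-≤ g g≤b (x ∷ xs) = +-mono-≤ (g≤b x) (sum-map-≤ g g≤b xs)

  sum-map-≤-count : {P : A → Set} (P? : ∀ x → Dec (P x)) (g : A → ℕ) {b : ℕ} →
    (∀ x → g x ≤ b) → (∀ x → ¬ P x → g x ≡ 0) → ∀ xs → sum (map g xs) ≤ count P? xs * b
  sum-map-≤-count P? g g≤b g≡0 [] = z≤n
  sum-map-≤-count P? g g≤b g≡0 (x ∷ xs) with P? x
  ... | yes _  = +-mono-≤ (g≤b x) (sum-map-≤-count P? g g≤b g≡0 xs)
  ... | no ¬Px = subst (_≤ _) (cong (_+ sum (map g xs)) (sym (g≡0 x ¬Px))) (sum-map-≤-count P? g g≤b g≡0 xs)

  sum-map+≤ : (g : A → ℕ) {b : ℕ} → (∀ x → g x ≤ b) → ∀ {z xs} → z ∈ xs → g z ≡ 0 →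
    sum (map g xs) + b ≤ length xs * b
  sum-map+≤ g {b} g≤b {xs = x ∷ xs} (here refl) gx≡0 = begin
    (g x + sum (map g xs)) + b ≡⟨ cong (λ y → (y + sum (map g xs)) + b) gx≡0 ⟩
    sum (map g xs) + b         ≡⟨ +-comm _ b ⟩
    b + sum (map g xs)         ≤⟨ +-monoʳ-≤ b (sum-map-≤ g g≤b xs) ⟩
    b + length xs * b          ∎
    where open ≤-Reasoning
  sum-map+≤ g {b} g≤b {xs = x ∷ xs} (there z∈xs) gz≡0 = begin
    (g x + sum (map g xs)) + b ≡⟨ +-assoc (g x) _ b ⟩
    g x + (sum (map g xs) + b) ≤⟨ +-mono-≤ (g≤b x) (sum-map+≤ g g≤b z∈xs gz≡0) ⟩
    b + length xs * b          ∎
    where open ≤-Reasoning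

  Unique-⊆⇒length≤ : ∀ {xs ys : List A} → Unique xs → (∀ {x} → x ∈ xs → x ∈ ys) → length xs ≤ length ys
  Unique-⊆⇒length≤ {xs = []} _ _ = z≤n
  Unique-⊆⇒length≤ {xs = x ∷ xs} {ys} (x∉xs ∷ unique) xs⊆ys with ∈-∃++ (xs⊆ys (here refl))
  ... | as , bs , refl = begin
    suc (length xs)             ≤⟨ s≤s (Unique-⊆⇒length≤ unique xs⊆as++bs) ⟩
    suc (length (as ++ bs))     ≡⟨ cong suc (length-++ as) ⟩
    suc (length as + length bs) ≡⟨ sym (+-suc (length as) (length bs)) ⟩
    length as + length (x ∷ bs) ≡⟨ sym (length-++ as) ⟩
    length (as ++ x ∷ bs)       ∎
    where
    open ≤-Reasoning
    ≢-∈ : ∀ {y zs} → All (x ≢_) zs → y ∈ zs → x ≢ y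
    ≢-∈ (x≢y ∷ _) (here refl) = x≢y
    ≢-∈ (_ ∷ x≢zs) (there y∈zs) = ≢-∈ x≢zs y∈zs
    xs⊆as++bs : ∀ {y} → y ∈ xs → y ∈ as ++ bs
    xs⊆as++bs y∈xs with ∈-++⁻ as (xs⊆ys (there y∈xs))
    ... | inj₁ y∈as = ∈-++⁺ˡ y∈as
    ... | inj₂ (here refl) = ⊥-elim (≢-∈ x∉xs y∈xs refl)
    ... | inj₂ (there y∈bs) = ∈-++⁺ʳ as y∈bs

  vectors : List A → (n : ℕ) → List (Vec A n)
  vectors xs zero    = [] ∷ []
  vectors xs (suc n) = cartesianProductWith _∷_ xs (vectors xs n)

  length-cartesianProductWith : (f : A → B → C) (xs : List A) (ys : List B) →
    length (cartesianProductWith f xs ys) ≡ length xs * length ys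
  length-cartesianProductWith f [] ys = refl
  length-cartesianProductWith f (x ∷ xs) ys = trans (length-++ (map (f x) ys))
    (cong₂ _+_ (length-map (f x) ys) (length-cartesianProductWith f xs ys))

  length-vectors : (xs : List A) (n : ℕ) → length (vectors xs n) ≡ length xs ^ n
  length-vectors xs zero    = refl
  length-vectors xs (suc n) = trans (length-cartesianProductWith _∷_ xs (vectors xs n))
    (cong (length xs *_) (length-vectors xs n))

  ∈-vectors : {xs : List A} → (∀ x → x ∈ xs) → ∀ {n} (v : Vec A n) → v ∈ vectors xs n
  ∈-vectors xs-complete []      = here refl
  ∈-vectors xs-complete (x ∷ v) = ∈-cartesianProductWith⁺ _∷_ (xs-complete x) (∈-vectors xs-complete v)

  vectors-unique : {xs : List A} → Unique xs → ∀ n → Unique (vectors xs n)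
  vectors-unique unique zero    = [] ∷ []
  vectors-unique unique (suc n) = Unique.cartesianProductWith⁺ _∷_ Vec.∷-injective unique (vectors-unique unique n)

  count-vectors-all : {P : A → Set} (P? : ∀ x → Dec (P x)) (xs : List A) (n : ℕ) →
    count (λ (v : Vec A n) → Fin.all? (λ s → P? (lookup v s))) (vectors xs n) ≤ count P? xs ^ n
  count-vectors-all P? xs zero = count-≤-length (λ (v : Vec _ zero) → Fin.all? (λ s → P? (lookup v s))) (vectors xs zero)
  count-vectors-all {P = P} P? xs (suc n) = begin
    count All? (cartesianProductWith _∷_ xs (vectors xs n))        ≡⟨ count-cartesianProductWith All? _∷_ xs (vectors xs n) ⟩
    sum (map (λ x → count (λ v → All? (x ∷ v)) (vectors xs n)) xs) ≤⟨ sum-map-≤-count P? _ tail-bound head-fails xs ⟩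
    count P? xs * count P? xs ^ n                                  ∎
    where
    open ≤-Reasoning
    All? : ∀ (v : Vec _ (suc n)) → Dec (∀ s → P (lookup v s))
    All? v = Fin.all? (λ s → P? (lookup v s))
    tail-bound : ∀ x → count (λ v → All? (x ∷ v)) (vectors xs n) ≤ count P? xs ^ n
    tail-bound x = ≤-trans (count-mono (λ v → All? (x ∷ v)) _ (λ v all → all ∘ Fin.suc) (vectors xs n))
                           (count-vectors-all P? xs n)
    head-fails : ∀ x → ¬ P x → count (λ v → All? (x ∷ v)) (vectors xs n) ≡ 0
    head-fails x ¬Px = count-empty (λ v → All? (x ∷ v)) (λ v all → ¬Px (all Fin.zero)) (vectors xs n)

  record Enumeration (A : Set) : Set where
    field
      elements : List A
      complete : ∀ x → x ∈ elements
      unique   : Unique elements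

    size : ℕ
    size = length elements

    infix 4 _≟_
    _≟_ : (x y : A) → Dec (x ≡ y)
    x ≟ y with Any.index (complete x) Fin.≟ Any.index (complete y)
    ... | yes i≡j = yes (trans (Any.lookup-index (complete x))
                          (trans (cong (List.lookup elements) i≡j) (sym (Any.lookup-index (complete y)))))
    ... | no  i≢j = no (λ x≡y → i≢j (cong (λ z → Any.index (complete z)) x≡y))

  vectorEnumeration : Enumeration A → (n : ℕ) → Enumeration (Vec A n)
  vectorEnumeration e n = record
    { elements = vectors elements n
    ; complete = ∈-vectors complete
    ; unique   = vectors-unique unique n
    }
    where open Enumeration e

  size-vectorEnumeration : (e : Enumeration A) (n : ℕ) →
    Enumeration.size (vectorEnumeration e n) ≡ Enumeration.size e ^ n
  size-vectorEnumeration e = length-vectors (Enumeration.elements e)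

  imageEnumeration : Enumeration A → (f : A → B) → (∀ {x y} → f x ≡ f y → x ≡ y) →
                     (∀ y → ∃ λ x → f x ≡ y) → Enumeration B
  imageEnumeration e f f-injective f-surjective = record
    { elements = map f elements
    ; complete = λ y → let x , fx≡y = f-surjective y in subst (_∈ map f elements) fx≡y (∈-map⁺ f (complete x))
    ; unique   = Unique.map⁺ f-injective unique
    }
    where open Enumeration e

  size-imageEnumeration : (e : Enumeration A) (f : A → B) (f-injective : ∀ {x y} → f x ≡ f y → x ≡ y)
    (f-surjective : ∀ y → ∃ λ x → f x ≡ y) →
    Enumeration.size (imageEnumeration e f f-injective f-surjective) ≡ Enumeration.size e
  size-imageEnumeration e f _ _ = length-map f (Enumeration.elements e)

  size>0 : (e : Enumeration A) → A → 0 < Enumeration.size e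
  size>0 e x with Enumeration.elements e | Enumeration.complete e x
  ... | _ ∷ _ | _ = s≤s z≤n

open Counting

module HyperplaneCount (K : Field) (enum : Enumeration (Field.Carrier K)) where
  open FieldProperties K
  open Enumeration enum

  infix 7 _∙_
  _∙_ : ∀ {k} → Vec Carrier k → (Fin k → Carrier) → Carrier
  a ∙ w = Σ[ (λ r → lookup a r * w r) ]

  count-solutions : ∀ {k} → (Fin k → Carrier) → Carrier → ℕ
  count-solutions {k} w c = count (λ a → a ∙ w ≟ c) (vectors elements k)

  count-solutions-∷ : ∀ {k} (w : Fin (suc k) → Carrier) c →
    count-solutions w c ≡ sum (map (λ x → count (λ a → (x ∷ a) ∙ w ≟ c) (vectors elements k)) elements)
  count-solutions-∷ {k} w c = count-cartesianProductWith (λ a → a ∙ w ≟ c) _∷_ elements (vectors elements k)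

  count-solutions-pivot : ∀ {k} (w : Fin (suc k) → Carrier) → w Fin.zero ≢ 0# →
    (∀ r → w (Fin.suc r) ≡ 0#) → ∀ c → count-solutions w c ≤ size ℕ.^ k
  count-solutions-pivot {k} w w₀≢0 w-tail≡0 c = begin
    count-solutions w c
      ≡⟨ count-solutions-∷ w c ⟩
    sum (map (λ x → count (λ a → (x ∷ a) ∙ w ≟ c) (vectors elements k)) elements)
      ≤⟨ sum-map-≤-count (λ x → x * w Fin.zero ≟ c) _ at-most-all off-pivot elements ⟩
    count (λ x → x * w Fin.zero ≟ c) elements ℕ.* size ℕ.^ k
      ≤⟨ *-monoˡ-≤ (size ℕ.^ k) (count-≤1 (λ x → x * w Fin.zero ≟ c)
           (λ xw≡c yw≡c → *-cancelʳ w₀≢0 (trans xw≡c (sym yw≡c))) unique) ⟩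
    1 ℕ.* size ℕ.^ k
      ≡⟨ ℕₚ.*-identityˡ (size ℕ.^ k) ⟩
    size ℕ.^ k ∎
    where
    open ≤-Reasoning
    [x∷a]∙w≡xw₀ : ∀ x (a : Vec Carrier k) → (x ∷ a) ∙ w ≡ x * w Fin.zero
    [x∷a]∙w≡xw₀ x a = trans (cong (x * w Fin.zero +_) (Σ-zero (λ r → trans (cong (lookup a r *_) (w-tail≡0 r)) (zeroʳ _))))
                            (+-identityʳ _)
    at-most-all : ∀ x → count (λ a → (x ∷ a) ∙ w ≟ c) (vectors elements k) ≤ size ℕ.^ k
    at-most-all x = ≤-trans (count-≤-length (λ a → (x ∷ a) ∙ w ≟ c) (vectors elements k))
                            (≤-reflexive (length-vectors elements k))
    off-pivot : ∀ x → ¬ (x * w Fin.zero ≡ c) → count (λ a → (x ∷ a) ∙ w ≟ c) (vectors elements k) ≡ 0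
    off-pivot x xw₀≢c = count-empty (λ a → (x ∷ a) ∙ w ≟ c)
                          (λ a [x∷a]∙w≡c → xw₀≢c (trans (sym ([x∷a]∙w≡xw₀ x a)) [x∷a]∙w≡c))
                                    (vectors elements k)

  count-solutions-≤ : ∀ {k} (w : Fin (suc k) → Carrier) → (∃ λ r → w r ≢ 0#) → ∀ c →
                      count-solutions w c ≤ size ℕ.^ k
  count-solutions-≤ {zero} w (Fin.zero , w₀≢0) c = count-solutions-pivot w w₀≢0 (λ ()) c
  count-solutions-≤ {suc k} w w≢0 c with Fin.any? (λ r → ¬? (w (Fin.suc r) ≟ 0#))
  ... | yes w-tail≢0 = begin
    count-solutions w c
      ≡⟨ count-solutions-∷ w c ⟩
    sum (map (λ x → count (λ a → (x ∷ a) ∙ w ≟ c) (vectors elements (suc k))) elements)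
      ≤⟨ sum-map-≤ _ tail-bound elements ⟩
    size ℕ.* size ℕ.^ k ∎
    where
    open ≤-Reasoning
    tail-bound : ∀ x → count (λ a → (x ∷ a) ∙ w ≟ c) (vectors elements (suc k)) ≤ size ℕ.^ k
    tail-bound x = ≤-trans (count-mono (λ a → (x ∷ a) ∙ w ≟ c) (λ a → a ∙ (w ∘ Fin.suc) ≟ c - x * w Fin.zero)
                                       (λ a → x+y≡z⇒y≡z-x) (vectors elements (suc k)))
                           (count-solutions-≤ (w ∘ Fin.suc) w-tail≢0 (c - x * w Fin.zero))
  ... | no w-tail≢0 = count-solutions-pivot w (w₀≢0 w≢0) tail≡0 c
    where
    tail≡0 : ∀ r → w (Fin.suc r) ≡ 0#
    tail≡0 r = decidable-stable (w (Fin.suc r) ≟ 0#) (λ wr≢0 → w-tail≢0 (r , wr≢0))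
    w₀≢0 : (∃ λ r → w r ≢ 0#) → w Fin.zero ≢ 0#
    w₀≢0 (Fin.zero  , w₀≢0) = w₀≢0
    w₀≢0 (Fin.suc r , wr≢0) = ⊥-elim (wr≢0 (tail≡0 r))

lookup-injective : ∀ {A : Set} {n} {v w : Vec A n} → (∀ i → lookup v i ≡ lookup w i) → v ≡ w
lookup-injective {v = v} {w} v≗w =
  trans (sym (Vec.tabulate∘lookup v)) (trans (Vec.tabulate-cong v≗w) (Vec.tabulate∘lookup w))

module ExtensionProperties {F : Field} {m : ℕ} (E : Extension F m) where
  open Extension E public using (ι; ι-+; ι-*; Γ; coord; expand; unique)
  module F = FieldProperties F
  module L = FieldProperties (Extension.L E)
  open ≡-Reasoning

  ι-0 : ι F.0# ≡ L.0#
  ι-0 = L.+-identityʳ-unique (ι F.0#) (ι F.0#) (trans (sym (ι-+ F.0# F.0#)) (cong ι (F.+-identityʳ F.0#)))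

  ι-Σ : ∀ {t} (f : Fin t → F.Carrier) → ι F.Σ[ f ] ≡ L.Σ[ (λ i → ι (f i)) ]
  ι-Σ {zero}  f = ι-0
  ι-Σ {suc t} f = trans (ι-+ _ _) (cong (ι (f Fin.zero) L.+_) (ι-Σ (λ i → f (Fin.suc i))))

  fromCoords : (Fin m → F.Carrier) → L.Carrier
  fromCoords c = L.Σ[ (λ j → ι (c j) L.* Γ j) ]

  coord-fromCoords : ∀ c j → coord (fromCoords c) j ≡ c j
  coord-fromCoords c j = sym (unique (fromCoords c) c refl j)

  coord-injective : ∀ {x y} → (∀ j → coord x j ≡ coord y j) → x ≡ y
  coord-injective {x} {y} x≗y = begin
    x                       ≡⟨ expand x ⟩
    fromCoords (coord x)    ≡⟨ L.Σ-cong (λ j → cong (λ a → ι a L.* Γ j) (x≗y j)) ⟩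
    fromCoords (coord y)    ≡⟨ sym (expand y) ⟩
    y                       ∎

  fromCoords∘lookup-injective : ∀ {c c′ : Vec F.Carrier m} → fromCoords (lookup c) ≡ fromCoords (lookup c′) → c ≡ c′
  fromCoords∘lookup-injective {c} {c′} eq = lookup-injective (λ j → begin
    lookup c j                        ≡⟨ sym (coord-fromCoords (lookup c) j) ⟩
    coord (fromCoords (lookup c)) j   ≡⟨ cong (λ x → coord x j) eq ⟩
    coord (fromCoords (lookup c′)) j  ≡⟨ coord-fromCoords (lookup c′) j ⟩
    lookup c′ j                       ∎)

  fromCoords∘lookup-surjective : ∀ x → ∃ λ (c : Vec F.Carrier m) → fromCoords (lookup c) ≡ x
  fromCoords∘lookup-surjective x = tabulate (coord x) ,
    coord-injective (λ j → trans (coord-fromCoords _ j) (Vec.lookup∘tabulate (coord x) j))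

  coord-0 : ∀ j → coord L.0# j ≡ F.0#
  coord-0 j = sym (unique L.0# (λ _ → F.0#) (sym (L.Σ-zero (λ j → trans (cong (L._* Γ j) ι-0) (L.zeroˡ (Γ j))))) j)

  coord-Σ : ∀ {t} (u : Fin t → F.Carrier) (z : Fin t → L.Carrier) j →
            coord L.Σ[ (λ i → ι (u i) L.* z i) ] j ≡ F.Σ[ (λ i → u i F.* coord (z i) j) ]
  coord-Σ {t} u z = sym ∘ unique _ (λ j → F.Σ[ (λ i → u i F.* coord (z i) j) ]) (begin
    L.Σ[ (λ i → ι (u i) L.* z i) ]
      ≡⟨ L.Σ-cong (λ i → cong (ι (u i) L.*_) (expand (z i))) ⟩
    L.Σ[ (λ i → ι (u i) L.* L.Σ[ (λ j → ι (coord (z i) j) L.* Γ j) ]) ]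
      ≡⟨ L.Σ-cong (λ i → L.*-distribˡ-Σ (ι (u i)) (λ j → ι (coord (z i) j) L.* Γ j)) ⟩
    L.Σ[ (λ i → L.Σ[ (λ j → ι (u i) L.* (ι (coord (z i) j) L.* Γ j)) ]) ]
      ≡⟨ L.Σ-comm (λ i j → ι (u i) L.* (ι (coord (z i) j) L.* Γ j)) ⟩
    L.Σ[ (λ j → L.Σ[ (λ i → ι (u i) L.* (ι (coord (z i) j) L.* Γ j)) ]) ]
      ≡⟨ L.Σ-cong (λ j → L.Σ-cong (λ i →
           trans (sym (L.*-assoc _ _ (Γ j))) (cong (L._* Γ j) (sym (ι-* (u i) (coord (z i) j)))))) ⟩
    L.Σ[ (λ j → L.Σ[ (λ i → ι (u i F.* coord (z i) j) L.* Γ j) ]) ]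
      ≡⟨ L.Σ-cong (λ j → sym (L.*-distribʳ-Σ (Γ j) (λ i → ι (u i F.* coord (z i) j)))) ⟩
    L.Σ[ (λ j → L.Σ[ (λ i → ι (u i F.* coord (z i) j)) ] L.* Γ j) ]
      ≡⟨ L.Σ-cong (λ j → cong (L._* Γ j) (sym (ι-Σ (λ i → u i F.* coord (z i) j)))) ⟩
    L.Σ[ (λ j → ι F.Σ[ (λ i → u i F.* coord (z i) j) ] L.* Γ j) ] ∎)

Unique-toList : ∀ {A : Set} {n} {xs : Vec A n} → VecUnique.Unique xs → Unique (toList xs)
Unique-toList []              = []
Unique-toList (x∉xs ∷ unique) = VecAll.toList⁺ x∉xs ∷ Unique-toList unique

module FiniteExtension {q} (Fq : FiniteField q) {m} (E : Extension (FiniteField.field' Fq) m) where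
  open FiniteField Fq using (elems; complete; distinct)
  open ExtensionProperties E

  F-enumeration : Enumeration F.Carrier
  F-enumeration = record
    { elements = toList elems
    ; complete = ∈-toList⁺ ∘ complete
    ; unique   = Unique-toList distinct
    }

  size-F-enumeration : Enumeration.size F-enumeration ≡ q
  size-F-enumeration = Vec.length-toList elems

  L-enumeration : Enumeration L.Carrier
  L-enumeration = imageEnumeration (vectorEnumeration F-enumeration m) (fromCoords ∘ lookup)
    fromCoords∘lookup-injective fromCoords∘lookup-surjective

  size-L-enumeration : Enumeration.size L-enumeration ≡ q ℕ.^ m
  size-L-enumeration = trans (size-imageEnumeration (vectorEnumeration F-enumeration m) (fromCoords ∘ lookup)
                                                fromCoords∘lookup-injective fromCoords∘lookup-surjective)
    (trans (size-vectorEnumeration F-enumeration m) (cong (ℕ._^ m) size-F-enumeration))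

module CodeProperties {F : Field} {m : ℕ} {E : Extension F m} {n k : ℕ} (C : Code E n k) where
  open Code C
  open ExtensionProperties E
  open Matrices F using (_·_; Σ-*-·)
  open ≡-Reasoning

  combination∈ : ∀ {t} (b : Fin t → Vecₗ E n) → (∀ r → inC (b r)) → ∀ (a : Fin t → L.Carrier) →
                 inC (λ i → L.Σ[ (λ r → a r L.* b r i) ])
  combination∈ {zero}  b b∈ a = zero∈
  combination∈ {suc t} b b∈ a = +∈ _ _ (scale∈ (a Fin.zero) (b Fin.zero) (b∈ Fin.zero))
    (combination∈ (λ r → b (Fin.suc r)) (λ r → b∈ (Fin.suc r)) (λ r → a (Fin.suc r)))

  pairing : (Fin n → F.Carrier) → Vecₗ E n → L.Carrier
  pairing u x = L.Σ[ (λ i → ι (u i) L.* x i) ]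

  pairing-basis≡0⇒pairing-codeword≡0 : ∀ u → (∀ r → pairing u (basis r) ≡ L.0#) → ∀ x → inC x → pairing u x ≡ L.0#
  pairing-basis≡0⇒pairing-codeword≡0 u u⊥basis x x∈C with spans x x∈C
  ... | a , x≡Σabasis = begin
    pairing u x
      ≡⟨ L.Σ-cong (λ i → cong (ι (u i) L.*_) (x≡Σabasis i)) ⟩
    L.Σ[ (λ i → ι (u i) L.* L.Σ[ (λ r → a r L.* basis r i) ]) ]
      ≡⟨ L.Σ-*-Σ-comm (λ i → ι (u i)) a (λ i r → basis r i) ⟩
    L.Σ[ (λ r → a r L.* pairing u (basis r)) ]
      ≡⟨ L.Σ-zero (λ r → trans (cong (a r L.*_) (u⊥basis r)) (L.zeroʳ (a r))) ⟩
    L.0# ∎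

  ⊥basis⇒zero : NonDegenerate E C → ∀ u → (∀ r → pairing u (basis r) ≡ L.0#) → ∀ i → u i ≡ F.0#
  ⊥basis⇒zero nondegenerate u u⊥basis i₀ with nondegenerate (F.δ i₀)
  ... | t , xs , xs∈C , c , δ≡c·M = begin
    u i₀                                           ≡⟨ sym (F.Σ-*-δ u i₀) ⟩
    F.Σ[ (λ i → u i F.* F.δ i₀ i) ]                ≡⟨ F.Σ-cong (λ i → cong (u i F.*_) (δ≡c·M i)) ⟩
    F.Σ[ (λ i → u i F.* (c · M i)) ]               ≡⟨ Σ-*-· u c M ⟩
    c · (λ s j → F.Σ[ (λ i → u i F.* M i s j) ])   ≡⟨ F.Σ-zero (λ s → F.Σ-zero (λ j →
                                                        trans (cong (c s j F.*_) (u⊥supports s j)) (F.zeroʳ (c s j)))) ⟩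
    F.0#                                           ∎
    where
    M : Fin n → Fin t → Fin m → F.Carrier
    M i s j = coord (xs s i) j
    u⊥supports : ∀ s j → F.Σ[ (λ i → u i F.* M i s j) ] ≡ F.0#
    u⊥supports s j = begin
      F.Σ[ (λ i → u i F.* coord (xs s i) j) ]
        ≡⟨ sym (coord-Σ u (xs s) j) ⟩
      coord (pairing u (xs s)) j
        ≡⟨ cong (λ x → coord x j) (pairing-basis≡0⇒pairing-codeword≡0 u u⊥basis (xs s) (xs∈C s)) ⟩
      coord L.0# j
        ≡⟨ coord-0 j ⟩
      F.0# ∎

nondegenerate⇒1≤dimension : ∀ {F m} {E : Extension F m} {n k} (C : Code E n k) → 1 ≤ n → NonDegenerate E C → 1 ≤ k
nondegenerate⇒1≤dimension {k = suc _} C _ _ = s≤s z≤n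
nondegenerate⇒1≤dimension {F} {k = zero} C (s≤s z≤n) nondegenerate =
  ⊥-elim (0≢1 (sym (CodeProperties.⊥basis⇒zero C nondegenerate (λ _ → 1#) (λ ()) Fin.zero)))
  where open Field F

module CriticalExponentBounds {q} (Fq : FiniteField q) {m} (E : Extension (FiniteField.field' Fq) m) where
  open FiniteExtension Fq E
  open ExtensionProperties E
  open Matrices (FiniteField.field' Fq) using (_·_; ·-congˡ; columnsSpan⊎rowsDependent)
  module Fₑ = Enumeration F-enumeration

  fullSupport⇒q^n≤q^[m*t] : ∀ {n t} (xs : Fin t → Vecₗ E n) → SupportsSumFull E xs → q ℕ.^ n ≤ q ℕ.^ (m ℕ.* t)
  fullSupport⇒q^n≤q^[m*t] {n} {t} xs full = begin
    q ℕ.^ n                              ≡⟨ cong (ℕ._^ n) (sym size-F-enumeration) ⟩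
    Fₑ.size ℕ.^ n                        ≡⟨ sym (length-vectors Fₑ.elements n) ⟩
    length (vectors Fₑ.elements n)       ≤⟨ Unique-⊆⇒length≤ (vectors-unique Fₑ.unique n) (λ {v} _ → image v) ⟩
    length (map φ coefficients)          ≡⟨ length-map φ coefficients ⟩
    length coefficients                  ≡⟨ length-vectors (vectors Fₑ.elements m) t ⟩
    length (vectors Fₑ.elements m) ℕ.^ t ≡⟨ cong (ℕ._^ t) (length-vectors Fₑ.elements m) ⟩
    (Fₑ.size ℕ.^ m) ℕ.^ t                ≡⟨ cong (λ x → (x ℕ.^ m) ℕ.^ t) size-F-enumeration ⟩
    (q ℕ.^ m) ℕ.^ t                      ≡⟨ ^-*-assoc q m t ⟩
    q ℕ.^ (m ℕ.* t)                      ∎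
    where
    open ≤-Reasoning
    coefficients : List (Vec (Vec F.Carrier m) t)
    coefficients = vectors (vectors Fₑ.elements m) t
    M : Fin n → Fin t → Fin m → F.Carrier
    M i s j = coord (xs s i) j
    φ : Vec (Vec F.Carrier m) t → Vec F.Carrier n
    φ c = tabulate (λ i → (λ s j → lookup (lookup c s) j) · M i)
    image : ∀ v → v ∈ map φ coefficients
    image v with full (lookup v)
    ... | c , v≡c·M = subst (_∈ map φ coefficients) φc′≡v
                        (∈-map⁺ φ (∈-vectors (∈-vectors Fₑ.complete) c′))
      where
      c′ : Vec (Vec F.Carrier m) t
      c′ = tabulate (λ s → tabulate (c s))
      c′≡c : ∀ s j → lookup (lookup c′ s) j ≡ c s j
      c′≡c s j = trans (cong (λ r → lookup r j) (Vec.lookup∘tabulate _ s)) (Vec.lookup∘tabulate (c s) j)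
      φc′≡v : φ c′ ≡ v
      φc′≡v = lookup-injective (λ i → trans (Vec.lookup∘tabulate _ i)
                (trans (·-congˡ (M i) c′≡c) (sym (v≡c·M i))))

  module UpperBound {n k} (C : Code E n (suc k)) (nondegenerate : NonDegenerate E C) where
    open Code C
    open CodeProperties C
    module Lₑ = Enumeration L-enumeration
    open HyperplaneCount (Extension.L E) L-enumeration using (_∙_; count-solutions-≤)

    syndrome : Vec F.Carrier n → Fin (suc k) → L.Carrier
    syndrome u r = pairing (lookup u) (basis r)

    syndrome≢0 : ∀ u → (∃ λ i → lookup u i ≢ F.0#) → ∃ λ r → syndrome u r ≢ L.0#
    syndrome≢0 u (i , uᵢ≢0) with Fin.any? (λ r → ¬? (syndrome u r Lₑ.≟ L.0#))
    ... | yes syndrome≢0 = syndrome≢0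
    ... | no  syndrome≡0 = ⊥-elim (uᵢ≢0 (⊥basis⇒zero nondegenerate (lookup u) u⊥basis i))
      where
      u⊥basis : ∀ r → syndrome u r ≡ L.0#
      u⊥basis r = decidable-stable (syndrome u r Lₑ.≟ L.0#) (λ ≢0 → syndrome≡0 (r , ≢0))

    codeword : Vec L.Carrier (suc k) → Vecₗ E n
    codeword a i = L.Σ[ (λ r → lookup a r L.* basis r i) ]

    pairing-codeword≡∙syndrome : ∀ (u : Fin n → F.Carrier) a → pairing u (codeword a) ≡ a ∙ (λ r → pairing u (basis r))
    pairing-codeword≡∙syndrome u a = L.Σ-*-Σ-comm (λ i → ι (u i)) (lookup a) (λ i r → basis r i)

    Annihilates : ∀ {T} → Vec F.Carrier n → Vec (Vec L.Carrier (suc k)) T → Set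
    Annihilates u a = (∃ λ i → lookup u i ≢ F.0#) × (∀ s → lookup a s ∙ syndrome u ≡ L.0#)

    nonzero? : ∀ (u : Vec F.Carrier n) → Dec (∃ λ i → lookup u i ≢ F.0#)
    nonzero? u = Fin.any? (λ i → ¬? (lookup u i Fₑ.≟ F.0#))

    annihilates? : ∀ {T} u (a : Vec (Vec L.Carrier (suc k)) T) → Dec (Annihilates u a)
    annihilates? u a = nonzero? u ×-dec Fin.all? (λ s → lookup a s ∙ syndrome u Lₑ.≟ L.0#)

    degenerate? : ∀ {T} (a : Vec (Vec L.Carrier (suc k)) T) → Dec (Any (λ u → Annihilates u a) (vectors Fₑ.elements n))
    degenerate? a = any? (λ u → annihilates? u a) (vectors Fₑ.elements n)

    tuples : (T : ℕ) → List (Vec (Vec L.Carrier (suc k)) T)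
    tuples T = vectors (vectors Lₑ.elements (suc k)) T

    count-annihilated : ∀ T u → count (annihilates? u) (tuples T) ≤ Lₑ.size ℕ.^ (k ℕ.* T)
    count-annihilated T u = by-cases (nonzero? u)
      where
      by-cases : Dec (∃ λ i → lookup u i ≢ F.0#) → count (annihilates? u) (tuples T) ≤ Lₑ.size ℕ.^ (k ℕ.* T)
      by-cases (no u≡0) = ≤-trans (≤-reflexive (count-empty (annihilates? u) (λ a → u≡0 ∘ proj₁) (tuples T))) z≤n
      by-cases (yes u≢0) = begin
        count (annihilates? u) (tuples T)
          ≤⟨ count-mono (annihilates? u) (λ a → Fin.all? (λ s → lookup a s ∙ syndrome u Lₑ.≟ L.0#)) (λ a → proj₂)
                        (tuples T) ⟩
        count (λ a → Fin.all? (λ s → lookup a s ∙ syndrome u Lₑ.≟ L.0#)) (tuples T)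
          ≤⟨ count-vectors-all (λ x → x ∙ syndrome u Lₑ.≟ L.0#) (vectors Lₑ.elements (suc k)) T ⟩
        count (λ x → x ∙ syndrome u Lₑ.≟ L.0#) (vectors Lₑ.elements (suc k)) ℕ.^ T
          ≤⟨ ^-monoˡ-≤ T (count-solutions-≤ (syndrome u) (syndrome≢0 u u≢0) L.0#) ⟩
        (Lₑ.size ℕ.^ k) ℕ.^ T
          ≡⟨ ^-*-assoc Lₑ.size k T ⟩
        Lₑ.size ℕ.^ (k ℕ.* T) ∎
        where open ≤-Reasoning

    count-degenerate<tuples : ∀ T → n ≤ m ℕ.* T → count degenerate? (tuples T) < length (tuples T)
    count-degenerate<tuples T n≤mT = <-≤-trans (m<m+n _ (m^n>0 Lₑ.size (k ℕ.* T))) (begin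
      count degenerate? (tuples T) ℕ.+ B
        ≤⟨ +-monoˡ-≤ B (count-⋃ degenerate? annihilates? (vectors Fₑ.elements n) (λ a → id) (tuples T)) ⟩
      sum (map (λ u → count (annihilates? u) (tuples T)) (vectors Fₑ.elements n)) ℕ.+ B
        ≤⟨ sum-map+≤ _ (count-annihilated T) (∈-vectors Fₑ.complete 0ⁿ)
             (count-empty (annihilates? 0ⁿ) 0ⁿ-annihilates-nothing (tuples T)) ⟩
      length (vectors Fₑ.elements n) ℕ.* B
        ≡⟨ cong (ℕ._* B) (trans (length-vectors Fₑ.elements n) (cong (ℕ._^ n) size-F-enumeration)) ⟩
      q ℕ.^ n ℕ.* B
        ≤⟨ *-monoˡ-≤ B (^-monoʳ-≤ q n≤mT) ⟩
      q ℕ.^ (m ℕ.* T) ℕ.* B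
        ≡⟨ cong (ℕ._* B) (trans (sym (^-*-assoc q m T)) (cong (ℕ._^ T) (sym size-L-enumeration))) ⟩
      Lₑ.size ℕ.^ T ℕ.* Lₑ.size ℕ.^ (k ℕ.* T)
        ≡⟨ sym (^-distribˡ-+-* Lₑ.size T (k ℕ.* T)) ⟩
      Lₑ.size ℕ.^ (suc k ℕ.* T)
        ≡⟨ sym (^-*-assoc Lₑ.size (suc k) T) ⟩
      (Lₑ.size ℕ.^ suc k) ℕ.^ T
        ≡⟨ sym (trans (length-vectors _ T) (cong (ℕ._^ T) (length-vectors Lₑ.elements (suc k)))) ⟩
      length (tuples T) ∎)
      where
      open ≤-Reasoning
      B : ℕ
      B = Lₑ.size ℕ.^ (k ℕ.* T)
      instance
        q≢0 : NonZero q
        q≢0 = >-nonZero (subst (0 <_) size-F-enumeration (size>0 F-enumeration F.0#))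
        |L|≢0 : NonZero Lₑ.size
        |L|≢0 = >-nonZero (size>0 L-enumeration L.0#)
      0ⁿ : Vec F.Carrier n
      0ⁿ = replicate n F.0#
      0ⁿ-annihilates-nothing : ∀ a → ¬ Annihilates 0ⁿ a
      0ⁿ-annihilates-nothing a ((i , 0ᵢ≢0) , _) = 0ᵢ≢0 (Vec.lookup-replicate i F.0#)

    nondegenerate-tuple⇒fullSupport : ∀ {T} (a : Vec (Vec L.Carrier (suc k)) T) →
      ¬ Any (λ u → Annihilates u a) (vectors Fₑ.elements n) → SupportsSumFull E (λ s → codeword (lookup a s))
    nondegenerate-tuple⇒fullSupport {T} a nondegenerate-tuple
      with columnsSpan⊎rowsDependent Fₑ._≟_ (λ i s j → coord (codeword (lookup a s) i) j)
    ... | inj₁ span = span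
    ... | inj₂ (u , u≢0 , u⊥supports) =
      ⊥-elim (nondegenerate-tuple (lose (∈-vectors Fₑ.complete (tabulate u)) (tabulate-u≢0 u≢0 , annihilates)))
      where
      open ≡-Reasoning
      tabulate-u≢0 : (∃ λ i → u i ≢ F.0#) → ∃ λ i → lookup (tabulate u) i ≢ F.0#
      tabulate-u≢0 (i , uᵢ≢0) = i , λ eq → uᵢ≢0 (trans (sym (Vec.lookup∘tabulate u i)) eq)
      annihilates : ∀ s → lookup a s ∙ syndrome (tabulate u) ≡ L.0#
      annihilates s = begin
        lookup a s ∙ syndrome (tabulate u)
          ≡⟨ L.Σ-cong (λ r → cong (lookup (lookup a s) r L.*_)
               (L.Σ-cong (λ i → cong (λ x → ι x L.* basis r i) (Vec.lookup∘tabulate u i)))) ⟩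
        lookup a s ∙ (λ r → pairing u (basis r))
          ≡⟨ sym (pairing-codeword≡∙syndrome u (lookup a s)) ⟩
        pairing u (codeword (lookup a s))
          ≡⟨ coord-injective (λ j → trans (coord-Σ u _ j) (trans (u⊥supports s j) (sym (coord-0 j)))) ⟩
        L.0# ∎

    fullSupportFamily : ∀ T → n ≤ m ℕ.* T → HasFullSupportFamily E C T
    fullSupportFamily T n≤mT with count<length⇒∃¬ degenerate? (tuples T) (count-degenerate<tuples T n≤mT)
    ... | a , nondegenerate-tuple =
      (λ s → codeword (lookup a s)) , (λ s → combination∈ basis basis∈ (lookup (lookup a s))) ,
      nondegenerate-tuple⇒fullSupport a nondegenerate-tuple

module Arithmetic where
  open Data.Nat using (_+_; _*_; _^_)
  open ℕₚ

  primePower≥2 : ∀ {q} → IsPrimePower q → 2 ≤ q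
  primePower≥2 (p , e , p-prime , refl) = ≤-trans (nonTrivial⇒n>1 p) (m≤m*n p (p ^ e))
    where instance
    _ = prime⇒nonTrivial p-prime
    _ = prime⇒nonZero p-prime
    _ = m^n≢0 p e

  ^-cancelʳ-≤ : ∀ {q a b} → 2 ≤ q → q ^ a ≤ q ^ b → a ≤ b
  ^-cancelʳ-≤ {q} 2≤q q^a≤q^b = ≮⇒≥ (λ b<a → <⇒≱ (^-monoʳ-< q 2≤q b<a) q^a≤q^b)

  n≤m*⌈n/m⌉ : ∀ n m → n ≤ suc m * ⌈ n / suc m ⌉
  n≤m*⌈n/m⌉ n m = +-cancelʳ-≤ m n (suc m * ⌈ n / suc m ⌉) (begin
    n + m                                   ≡⟨ m≡m%n+[m/n]*n (n + m) (suc m) ⟩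
    (n + m) % suc m + ⌈ n / suc m ⌉ * suc m ≤⟨ +-monoˡ-≤ _ (≤-pred (m%n<n (n + m) (suc m))) ⟩
    m + ⌈ n / suc m ⌉ * suc m               ≡⟨ +-comm m _ ⟩
    ⌈ n / suc m ⌉ * suc m + m               ≡⟨ cong (_+ m) (*-comm ⌈ n / suc m ⌉ (suc m)) ⟩
    suc m * ⌈ n / suc m ⌉ + m               ∎)
    where open ≤-Reasoning

  ⌈n/m⌉-least : ∀ {n m t} → n ≤ suc m * t → ⌈ n / suc m ⌉ ≤ t
  ⌈n/m⌉-least {n} {m} {t} n≤m*t = ≤-pred (m<n*o⇒m/o<n {n + m} {suc t} {suc m} (begin-strict
    n + m               ≤⟨ +-monoˡ-≤ m n≤m*t ⟩
    suc m * t + m       <⟨ +-monoʳ-< (suc m * t) (n<1+n m) ⟩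
    suc m * t + suc m   ≡⟨ +-comm _ (suc m) ⟩
    suc m + suc m * t   ≡⟨ cong (suc m +_) (*-comm (suc m) t) ⟩
    suc t * suc m       ∎))
    where open ≤-Reasoning

  1≤⌈n/m⌉ : ∀ {n} m → 1 ≤ n → 1 ≤ ⌈ n / suc m ⌉
  1≤⌈n/m⌉ m 1≤n = ≤-trans (≤-reflexive (sym (n/n≡1 (suc m)))) (/-monoˡ-≤ (suc m) (+-monoˡ-≤ m 1≤n))

open Arithmetic

theorem5p3 : (q : ℕ) → IsPrimePower q → (Fq : FiniteField q) →
    (n m : ℕ) → 2 ≤ n → 2 ≤ m →
    (E : Extension (FiniteField.field' Fq) m) →
    (k : ℕ) → (C : Code E n k) → NonDegenerate E C →
    CriticalExponentIs E C ⌈ n / m ⌉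
theorem5p3 q q-primePower Fq n (suc m) 2≤n _ E k C nondegenerate =
  1≤⌈n/m⌉ m 1≤n , family k C nondegenerate , least
  where
  open CriticalExponentBounds Fq E
  1≤n : 1 ≤ n
  1≤n = ≤-trans (s≤s z≤n) 2≤n
  family : ∀ k (C : Code E n k) → NonDegenerate E C → HasFullSupportFamily E C ⌈ n / suc m ⌉
  family zero    C nondegenerate with () ← nondegenerate⇒1≤dimension C 1≤n nondegenerate
  family (suc k) C nondegenerate = UpperBound.fullSupportFamily C nondegenerate ⌈ n / suc m ⌉ (n≤m*⌈n/m⌉ n m)
  least : ∀ t → 1 ≤ t → HasFullSupportFamily E C t → ⌈ n / suc m ⌉ ≤ t
  least t _ (xs , _ , full) =
    ⌈n/m⌉-least {n} {m} (^-cancelʳ-≤ (primePower≥2 q-primePower) (fullSupport⇒q^n≤q^[m*t] xs full))
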